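{- For every integer $n\geq 7$, the open diagonal ladder $O(DL_n)$ satisfies $\chi_g(O(DL_n))=9$.
   Context: All graphs are finite, simple and connected. A graceful $k$-coloring of a non-empty graph $G$ ($k\geq 2$) is a proper vertex coloring $f:V(G)\to\{1,2,\dots,k\}$ such that the induced edge coloring $f^*(uv)=|f(u)-f(v)|$, with values in $\{1,\dots,k-1\}$, is a proper edge coloring. The graceful chromatic number $\chi_g(G)$ is the minimum such $k$. The diagonal ladder $DL_n$ has vertex set $\{x_i,y_i:1\leq i\leq n\}$ and edge set $\{x_ix_{i+1},\,y_iy_{i+1},\,x_iy_{i+1},\,y_ix_{i+1}:1\leq i\leq n-1\}\cup\{x_iy_i:1\leq i\leq n\}$. The open diagonal ladder $O(DL_n)$ is obtained from $DL_n$ by removing the edges $x_1y_1$ and $x_ny_n$. -}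

module Defs where

open import Data.Nat using (ℕ; suc; _≤_; _<_)
open import Data.Nat.Properties using ()
open import Data.Fin using (Fin; toℕ)
open import Data.Bool using (Bool; true; false)
open import Data.Product using (_×_; _,_; Σ; ∃)
open import Data.Sum using (_⊎_)
open import Relation.Binary.PropositionalEquality using (_≡_; _≢_)
open import Relation.Nullary using (¬_)

open import Data.Nat using (∣_-_∣) public

record Graph : Set₁ where
  field
    V   : Set
    Adj : V → V → Set

open Graph public

record IsGracefulColoring (G : Graph) (k : ℕ) (f : V G → ℕ) : Set where
  field
    range    : ∀ v → 1 ≤ f v × f v ≤ k
    vproper  : ∀ u v → Adj G u v → f u ≢ f v
    eproper  : ∀ u v w → Adj G u v → Adj G v w → u ≢ w →
               ∣ f u - f v ∣ ≢ ∣ f v - f w ∣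

HasGracefulColoring : Graph → ℕ → Set
HasGracefulColoring G k = Σ (V G → ℕ) (IsGracefulColoring G k)

GracefulChromaticNumber : Graph → ℕ → Set
GracefulChromaticNumber G k =
  HasGracefulColoring G k × (∀ j → j < k → ¬ HasGracefulColoring G j)

-- Vertex (false , i) is x_{i+1}, (true , i) is y_{i+1}, for i : Fin n.
-- Edges: between consecutive rungs all four pairs (x_i x_{i+1}, y_i y_{i+1},
-- x_i y_{i+1}, y_i x_{i+1}) in either orientation; rungs x_i y_i for
-- 1 < i < n (i.e. 0 < toℕ i and suc (toℕ i) < n).
data ODLAdj (n : ℕ) : Bool × Fin n → Bool × Fin n → Set where
  step    : ∀ a b (i j : Fin n) → suc (toℕ i) ≡ toℕ j → ODLAdj n (a , i) (b , j)
  stepRev : ∀ a b (i j : Fin n) → suc (toℕ i) ≡ toℕ j → ODLAdj n (b , j) (a , i)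
  rung    : ∀ a (i : Fin n) → 0 < toℕ i → suc (toℕ i) < n →
            ODLAdj n (a , i) (Data.Bool.not a , i)

OpenDiagonalLadder : ℕ → Graph
OpenDiagonalLadder n = record { V = Bool × Fin n ; Adj = ODLAdj n }

-- Upper bound: color x_i and y_i by 1, 6, 3, 8 and 2, 7, 4, 9 according to
-- i mod 4.  Around any vertex v, the six vertices on the rung of v and on the
-- two adjacent rungs lie at pairwise distinct distances |f v - f u| from v
-- (v itself at distance 0), so the coloring and the induced edge coloring
-- are both proper.
-- Lower bound: graceful colorings restrict along graph embeddings, O(DL_7)
-- embeds in O(DL_n) for n ≥ 7, and an exhaustive search, pruned by checking
-- each constraint as soon as its vertices are colored, shows that O(DL_7)
-- has no graceful 8-coloring.
module Submission where

open import Defs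
open import Data.Nat using (ℕ; _≤_)
open import Data.Nat using (suc; _+_; _<_; s≤s; _<?_; _≤?_)
import Data.Nat.Properties as ℕ
open import Data.Bool using (Bool; true; false; not; _∧_; _∨_; T)
import Data.Bool.Properties as Bool
open import Data.Bool.ListAction using (all)
open import Data.Fin using (Fin; toℕ; inject≤)
import Data.Fin.Properties as Fin
open import Data.List using (List; []; _∷_; applyUpTo; concatMap; allFin; filter)
open import Data.List.Membership.Propositional using (_∈_)
open import Data.List.Membership.Propositional.Properties using (∈-applyUpTo⁺)
open import Data.List.Relation.Unary.All as All using (All; []; _∷_)
import Data.List.Relation.Unary.All.Properties as All
open import Data.List.Relation.Unary.All.Properties using (all⁺; all⁻)
open import Data.Product using (_×_; _,_; proj₁; proj₂; Σ)
open import Data.Product.Properties using (≡-dec; ,-injectiveˡ; ,-injectiveʳ)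
open import Data.Sum using (_⊎_; inj₁; inj₂)
open import Function using (_∘_; _⇔_; mk⇔; Equivalence)
open import Relation.Binary using (Decidable; DecidableEquality)
open import Relation.Binary.PropositionalEquality using (_≡_; _≢_; refl; sym; trans; cong; cong₂; subst)
open import Relation.Nullary using (¬_; Dec; ¬?)
open import Relation.Nullary.Decidable using (_×-dec_; _⊎-dec_; _→-dec_; from-yes; ⌊_⌋; fromWitness)
import Relation.Nullary.Decidable as Dec

T-not-∨ : ∀ {a b} → T (not a ∨ b) → T a → T b
T-not-∨ {true} t _ = t

all-Bool? : {P : Bool → Set} → (∀ b → Dec (P b)) → Dec (∀ b → P b)
all-Bool? P? = Dec.map′ (λ (f , t) → λ { false → f ; true → t })
                        (λ h → h false , h true)
                        (P? false ×-dec P? true)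

module _ {G : Graph} {f : V G → ℕ} where

  IsGracefulColoring-mono : ∀ {k l} → k ≤ l → IsGracefulColoring G k f → IsGracefulColoring G l f
  IsGracefulColoring-mono k≤l g = record
    { range = λ v → proj₁ (range v) , ℕ.≤-trans (proj₂ (range v)) k≤l
    ; vproper = vproper
    ; eproper = eproper
    }
    where open IsGracefulColoring g

record Embedding (H G : Graph) : Set where
  field
    vertex           : V H → V G
    vertex-injective : ∀ {u w} → vertex u ≡ vertex w → u ≡ w
    adjacent         : ∀ {u v} → Adj H u v → Adj G (vertex u) (vertex v)

module _ {H G : Graph} (e : Embedding H G) where
  open Embedding e

  IsGracefulColoring-restrict : ∀ {k f} → IsGracefulColoring G k f → IsGracefulColoring H k (f ∘ vertex)
  IsGracefulColoring-restrict g = record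
    { range = range ∘ vertex
    ; vproper = λ u v uv → vproper _ _ (adjacent uv)
    ; eproper = λ u v w uv vw u≢w → eproper _ _ _ (adjacent uv) (adjacent vw) (u≢w ∘ vertex-injective)
    }
    where open IsGracefulColoring g

  HasGracefulColoring-restrict : ∀ {k} → HasGracefulColoring G k → HasGracefulColoring H k
  HasGracefulColoring-restrict (f , g) = f ∘ vertex , IsGracefulColoring-restrict g

module GracefulSearch (G : Graph) (_≟_ : DecidableEquality (V G)) (adj? : Decidable (Adj G))
                      (adj-sym : ∀ {u v} → Adj G u v → Adj G v u) (k : ℕ) where

  colors : List ℕ
  colors = applyUpTo suc k

  Assignment : Set
  Assignment = List (V G × ℕ)

  Agrees : (V G → ℕ) → Assignment → Set
  Agrees f = All (λ (u , c) → f u ≡ c)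

  placedNeighbors : V G → Assignment → Assignment
  placedNeighbors v = filter (λ (w , _) → adj? v w)

  -- In the three checks below, v gets color c and N lists its neighbors in P.
  vertexProper : ℕ → Assignment → Bool
  vertexProper c N = all (λ (w , cw) → ⌊ ¬? (cw ℕ.≟ c) ⌋) N

  centreProper : ℕ → Assignment → Bool
  centreProper c N = all (λ (u , cu) → all (λ (w , cw) →
    ⌊ ¬? (u ≟ w) →-dec ¬? (∣ cu - c ∣ ℕ.≟ ∣ c - cw ∣) ⌋) N) N

  endProper : V G → ℕ → Assignment → Assignment → Bool
  endProper v c N P = all (λ (w , cw) → all (λ (z , cz) →
    ⌊ adj? w z →-dec ¬? (v ≟ z) →-dec ¬? (∣ c - cw ∣ ℕ.≟ ∣ cw - cz ∣) ⌋) P) N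

  compatible : V G → ℕ → Assignment → Assignment → Bool
  compatible v c N P = vertexProper c N ∧ centreProper c N ∧ endProper v c N P

  -- Every extension of P to vs violates a constraint.  Passing N as an
  -- argument makes it computed once for all colors of v.
  refuted : List (V G) → Assignment → Bool
  refuted []       P = false
  refuted (v ∷ vs) P = refutedAt (placedNeighbors v P)
    where
    refutedAt : Assignment → Bool
    refutedAt N = all (λ c → not (compatible v c N P) ∨ refuted vs ((v , c) ∷ P)) colors

  module _ {f : V G → ℕ} (g : IsGracefulColoring G k f) where
    open IsGracefulColoring g

    compatible-color : ∀ {P} → Agrees f P → ∀ v → T (compatible v (f v) (placedNeighbors v P) P)
    compatible-color {P} ag v =
      Equivalence.from Bool.T-∧ (vertexOK , Equivalence.from Bool.T-∧ (centreOK , endOK))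
      where
      neighbors : All (λ (w , cw) → f w ≡ cw × Adj G v w) (placedNeighbors v P)
      neighbors = All.zip (All.filter⁺ _ ag , All.all-filter _ P)

      vertexOK : T (vertexProper (f v) (placedNeighbors v P))
      vertexOK = all⁻ _ (All.map (λ { (refl , vw) → fromWitness (vproper _ _ (adj-sym vw)) }) neighbors)

      centreOK : T (centreProper (f v) (placedNeighbors v P))
      centreOK = all⁻ _ (All.map (λ { (refl , vu) → all⁻ _ (All.map (λ { (refl , vw) →
        fromWitness (λ u≢w → eproper _ _ _ (adj-sym vu) vw u≢w) }) neighbors) }) neighbors)

      endOK : T (endProper v (f v) (placedNeighbors v P) P)
      endOK = all⁻ _ (All.map (λ { (refl , vw) → all⁻ _ (All.map (λ { refl →
        fromWitness (λ wz v≢z → eproper _ _ _ vw wz v≢z) }) ag) }) neighbors)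

    color∈colors : ∀ v → f v ∈ colors
    color∈colors v with f v | range v
    ... | suc c | _ , c<k = ∈-applyUpTo⁺ suc c<k

    ¬refuted : ∀ {P} → Agrees f P → ∀ vs → ¬ T (refuted vs P)
    ¬refuted ag (v ∷ vs) r =
      ¬refuted (refl ∷ ag) vs (T-not-∨ (All.lookup (all⁺ _ _ r) (color∈colors v)) (compatible-color ag v))

  refuted⇒¬HasGracefulColoring : ∀ vs → refuted vs [] ≡ true → ¬ HasGracefulColoring G k
  refuted⇒¬HasGracefulColoring vs r (f , g) = ¬refuted g [] vs (Equivalence.from Bool.T-≡ r)

module _ {n : ℕ} where

  ODLAdjCases : Bool × Fin n → Bool × Fin n → Set
  ODLAdjCases (a , i) (b , j) =
    suc (toℕ i) ≡ toℕ j ⊎ suc (toℕ j) ≡ toℕ i ⊎ (b ≡ not a × i ≡ j × 0 < toℕ i × suc (toℕ i) < n)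

  ODLAdj⇔ : ∀ {a b i j} → ODLAdjCases (a , i) (b , j) ⇔ ODLAdj n (a , i) (b , j)
  ODLAdj⇔ {a} {b} {i} {j} = mk⇔ from to
    where
    to : ODLAdj n (a , i) (b , j) → ODLAdjCases (a , i) (b , j)
    to (step _ _ _ _ e)    = inj₁ e
    to (stepRev _ _ _ _ e) = inj₂ (inj₁ e)
    to (rung _ _ p q)      = inj₂ (inj₂ (refl , refl , p , q))
    from : ODLAdjCases (a , i) (b , j) → ODLAdj n (a , i) (b , j)
    from (inj₁ e)                            = step a b i j e
    from (inj₂ (inj₁ e))                     = stepRev b a j i e
    from (inj₂ (inj₂ (refl , refl , p , q))) = rung a i p q

  ODLAdj? : Decidable (ODLAdj n)
  ODLAdj? (a , i) (b , j) = Dec.map ODLAdj⇔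
    (suc (toℕ i) ℕ.≟ toℕ j ⊎-dec suc (toℕ j) ℕ.≟ toℕ i ⊎-dec
     (b Bool.≟ not a ×-dec i Fin.≟ j ×-dec 0 <? toℕ i ×-dec suc (toℕ i) <? n))

  ODLAdj-sym : ∀ {u v} → ODLAdj n u v → ODLAdj n v u
  ODLAdj-sym (step a b i j e)    = stepRev a b i j e
  ODLAdj-sym (stepRev a b i j e) = step a b i j e
  ODLAdj-sym (rung a i p q)      =
    subst (λ b → ODLAdj n (not a , i) (b , i)) (Bool.not-involutive a) (rung (not a) i p q)

  ODLAdj-irrefl : ∀ {u v} → ODLAdj n u v → u ≢ v
  ODLAdj-irrefl (step a b i j e)    refl = ℕ.1+n≢n e
  ODLAdj-irrefl (stepRev a b i j e) refl = ℕ.1+n≢n e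
  ODLAdj-irrefl (rung a i p q)      eq   = Bool.not-¬ refl (,-injectiveˡ eq)

OpenDiagonalLadder-embedding : ∀ {m n} → m ≤ n → Embedding (OpenDiagonalLadder m) (OpenDiagonalLadder n)
OpenDiagonalLadder-embedding {m} {n} m≤n = record
  { vertex           = embed
  ; vertex-injective = λ {(a , i)} {(b , j)} eq →
      cong₂ _,_ (,-injectiveˡ eq) (Fin.inject≤-injective m≤n m≤n i j (,-injectiveʳ eq))
  ; adjacent         = adjacent
  }
  where
  embed : Bool × Fin m → Bool × Fin n
  embed (a , i) = a , inject≤ i m≤n
  toℕ-inj : (i : Fin m) → toℕ (inject≤ i m≤n) ≡ toℕ i
  toℕ-inj i = Fin.toℕ-inject≤ i m≤n
  adjacent : ∀ {u v} → ODLAdj m u v → ODLAdj n (embed u) (embed v)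
  adjacent (step a b i j e)    = step a b _ _ (trans (cong suc (toℕ-inj i)) (trans e (sym (toℕ-inj j))))
  adjacent (stepRev a b i j e) = stepRev a b _ _ (trans (cong suc (toℕ-inj i)) (trans e (sym (toℕ-inj j))))
  adjacent (rung a i p q)      = rung a _ (subst (0 <_) (sym (toℕ-inj i)) p)
                                        (subst (λ x → suc x < n) (sym (toℕ-inj i)) (ℕ.≤-trans q m≤n))

ladderVertices : ∀ n → List (Bool × Fin n)
ladderVertices n = concatMap (λ i → (false , i) ∷ (true , i) ∷ []) (allFin n)

¬HasGracefulColoring-OpenDiagonalLadder-7-8 : ¬ HasGracefulColoring (OpenDiagonalLadder 7) 8
¬HasGracefulColoring-OpenDiagonalLadder-7-8 =
  refuted⇒¬HasGracefulColoring (ladderVertices 7) refl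
  where open GracefulSearch (OpenDiagonalLadder 7) (≡-dec Bool._≟_ Fin._≟_) ODLAdj? ODLAdj-sym 8

¬HasGracefulColoring-OpenDiagonalLadder : ∀ {n k} → 7 ≤ n → k < 9 → ¬ HasGracefulColoring (OpenDiagonalLadder n) k
¬HasGracefulColoring-OpenDiagonalLadder 7≤n (s≤s k≤8) (f , g) =
  ¬HasGracefulColoring-OpenDiagonalLadder-7-8
    (HasGracefulColoring-restrict (OpenDiagonalLadder-embedding 7≤n) (f , IsGracefulColoring-mono k≤8 g))

-- The periodic clause comes first, so that it also fires for a variable side.
ladderColor : Bool → ℕ → ℕ
ladderColor a (suc (suc (suc (suc i)))) = ladderColor a i
ladderColor false 0 = 1
ladderColor true  0 = 2
ladderColor false 1 = 6
ladderColor true  1 = 7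
ladderColor false 2 = 3
ladderColor true  2 = 4
ladderColor false 3 = 8
ladderColor true  3 = 9

windowGap : ℕ → Bool → Fin 3 → Bool → ℕ
windowGap r b δ a = ∣ ladderColor b (suc r) - ladderColor a (r + toℕ δ) ∣

LocallyGraceful : ℕ → Set
LocallyGraceful r =
    (∀ b → 1 ≤ ladderColor b (suc r) × ladderColor b (suc r) ≤ 9)
  × (∀ b δ a δ′ a′ → windowGap r b δ a ≡ windowGap r b δ′ a′ → (δ , a) ≡ (δ′ , a′))

locallyGraceful? : ∀ r → Dec (LocallyGraceful r)
locallyGraceful? r =
      all-Bool? (λ b → 1 ≤? ladderColor b (suc r) ×-dec ladderColor b (suc r) ≤? 9)
  ×-dec all-Bool? λ b → Fin.all? λ δ → all-Bool? λ a → Fin.all? λ δ′ → all-Bool? λ a′ →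
          windowGap r b δ a ℕ.≟ windowGap r b δ′ a′ →-dec ≡-dec Fin._≟_ Bool._≟_ (δ , a) (δ′ , a′)

-- Definitional periodicity reduces every rung to one of the four checked ones.
locallyGraceful : ∀ r → LocallyGraceful r
locallyGraceful 0 = from-yes (locallyGraceful? 0)
locallyGraceful 1 = from-yes (locallyGraceful? 1)
locallyGraceful 2 = from-yes (locallyGraceful? 2)
locallyGraceful 3 = from-yes (locallyGraceful? 3)
locallyGraceful (suc (suc (suc (suc r)))) = locallyGraceful r

module _ {n : ℕ} where

  periodicColoring : Bool × Fin n → ℕ
  periodicColoring (a , i) = ladderColor a (toℕ i)

  -- Rung i is rung j - 1 + δ; both sides are shifted by 4 to avoid
  -- truncated subtraction, harmless since the coloring has period 4.
  NearRung : Fin n → Fin n → Set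
  NearRung j i = Σ (Fin 3) λ δ → 3 + toℕ j + toℕ δ ≡ 4 + toℕ i

  nearRung-refl : ∀ {i} → NearRung i i
  nearRung-refl = Fin.suc Fin.zero , ℕ.+-comm _ 1

  adjacent⇒nearRung : ∀ {u v} → ODLAdj n u v → NearRung (proj₂ v) (proj₂ u)
  adjacent⇒nearRung (step a b i j e)    = Fin.zero , trans (ℕ.+-identityʳ _) (cong (3 +_) (sym e))
  adjacent⇒nearRung (stepRev a b i j e) = Fin.suc (Fin.suc Fin.zero) , trans (ℕ.+-comm _ 2) (cong (4 +_) e)
  adjacent⇒nearRung (rung a i p q)      = nearRung-refl

  gap≡windowGap : ∀ {b j a i} ((δ , e) : NearRung j i) →
                  ∣ periodicColoring (b , j) - periodicColoring (a , i) ∣ ≡ windowGap (3 + toℕ j) b δ a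
  gap≡windowGap {b} {j} {a} (δ , e) = cong (λ m → ∣ ladderColor b (toℕ j) - ladderColor a m ∣) (sym e)

  gap-injective : ∀ {v u w} → NearRung (proj₂ v) (proj₂ u) → NearRung (proj₂ v) (proj₂ w) →
                  ∣ periodicColoring v - periodicColoring u ∣ ≡ ∣ periodicColoring v - periodicColoring w ∣ →
                  u ≡ w
  gap-injective {b , j} {a , i} {c , l} u-near@(δ , e) w-near@(δ′ , e′) gaps
    with proj₂ (locallyGraceful (3 + toℕ j)) b δ a δ′ c
           (trans (sym (gap≡windowGap u-near)) (trans gaps (gap≡windowGap w-near)))
  ... | refl = cong (a ,_) (Fin.toℕ-injective (ℕ.+-cancelˡ-≡ 4 _ _ (trans (sym e) e′)))

  periodicColoring-graceful : IsGracefulColoring (OpenDiagonalLadder n) 9 periodicColoring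
  periodicColoring-graceful = record
    { range   = λ (a , i) → proj₁ (locallyGraceful (3 + toℕ i)) a
    ; vproper = λ u v uv fu≡fv → ODLAdj-irrefl uv
        (gap-injective (adjacent⇒nearRung uv) nearRung-refl
          (cong (λ c → ∣ periodicColoring v - c ∣) fu≡fv))
    ; eproper = λ u v w uv vw u≢w gaps → u≢w
        (gap-injective (adjacent⇒nearRung uv) (adjacent⇒nearRung (ODLAdj-sym vw))
          (trans (ℕ.∣-∣-comm (periodicColoring v) (periodicColoring u)) gaps))
    }

corollary3p8 : (n : ℕ) → 7 ≤ n → GracefulChromaticNumber (OpenDiagonalLadder n) 9
corollary3p8 n 7≤n =
    (periodicColoring , periodicColoring-graceful)
  , λ k k<9 → ¬HasGracefulColoring-OpenDiagonalLadder 7≤n k<9
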